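{- If $G$ is a finite simple graph with minimum degree $\delta(G)\ge 9$, then $\mathrm{Maj}'(G)\le 3$.
   Context: Two distinct edges are adjacent if they share an endpoint. An edge-coloring $c:E\to C$ (not necessarily proper) of a graph $G=(V,E)$ is a strong majority edge-coloring if for every edge $e\in E$ and every color $\alpha\in C$, at most half of the edges adjacent to $e$ have color $\alpha$. The strong majority index $\mathrm{Maj}'(G)$ is the least number of colors in such a coloring. -}

module Defs where

open import Data.Nat using (ℕ; _<_; _≤_; _*_)
open import Data.Nat.Properties using (_<?_)
open import Data.Fin using (Fin; toℕ)
open import Data.Fin.Properties using (_≟_)
open import Data.Bool using (Bool; true; false; _∧_; _∨_; not)
open import Data.Product using (Σ; _×_; _,_)
open import Data.List using (List; length; filter; allFin; concatMap; map)
open import Relation.Binary.PropositionalEquality using (_≡_)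
open import Relation.Nullary.Decidable using (⌊_⌋)

record Graph : Set where
  field
    n     : ℕ
    adj   : Fin n → Fin n → Bool
    sym   : ∀ u v → adj u v ≡ adj v u
    irrefl : ∀ v → adj v v ≡ false

module _ (G : Graph) where
  open Graph G

  degree : Fin n → ℕ
  degree v = length (filter (λ w → adj v w Data.Bool.≟ true) (allFin n))

  -- minimum degree at least d (vacuous on the empty graph)
  minDegree≥ : ℕ → Set
  minDegree≥ d = ∀ v → d ≤ degree v

  -- an edge {u,v} is represented uniquely by the ordered pair (u , v) with u < v
  Pair : Set
  Pair = Fin n × Fin n

  isEdge : Pair → Bool
  isEdge (u , v) = ⌊ toℕ u <? toℕ v ⌋ ∧ adj u v

  edges : List Pair
  edges = filter (λ e → isEdge e Data.Bool.≟ true)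
                 (concatMap (λ u → map (λ v → (u , v)) (allFin n)) (allFin n))

  sameEdge : Pair → Pair → Bool
  sameEdge (u , v) (x , y) = ⌊ u ≟ x ⌋ ∧ ⌊ v ≟ y ⌋

  adjacentEdges : Pair → Pair → Bool
  adjacentEdges e@(u , v) f@(x , y) =
    not (sameEdge e f) ∧ (⌊ u ≟ x ⌋ ∨ ⌊ u ≟ y ⌋ ∨ ⌊ v ≟ x ⌋ ∨ ⌊ v ≟ y ⌋)

  -- an edge colouring with colour set Fin k (only its values on edges matter)
  EdgeColouring : ℕ → Set
  EdgeColouring k = Pair → Fin k

  IsStrongMajority : ∀ {k} → EdgeColouring k → Set
  IsStrongMajority {k} c =
    ∀ e → isEdge e ≡ true → (α : Fin k) →
      2 * length (filter (λ f → (adjacentEdges e f ∧ ⌊ c f ≟ α ⌋) Data.Bool.≟ true) edges)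
        ≤ length (filter (λ f → adjacentEdges e f Data.Bool.≟ true) edges)

  -- Maj'(G) ≤ k : there is a strong majority edge-colouring using at most k colours
  -- (colours need not all be used, so this is colouring into Fin k)
  MajIndex≤ : ℕ → Set
  MajIndex≤ k = Σ (EdgeColouring k) IsStrongMajority

{-# OPTIONS --safe #-}

-- Call an edge colouring balanced if at every vertex any two colour classes differ in size by at
-- most 2.  Balanced colourings exist for any number of colours: while some vertex v has at least
-- 3 more α- than β-edges, swap α and β along a maximal α/β-alternating trail leaving v by an
-- α-edge.  Inner vertices of the trail keep their colour degrees, v trades an α for a β, and by
-- maximality the last vertex does not get worse, so the sum over all vertices and colours of the
-- squared colour degrees drops.  With three colours and minimum degree at least 9, balance gives
-- 2 d_κ(y) + 1 ≤ deg y at every vertex y; adding this at both ends of an edge uw shows that at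
-- most half of the deg u + deg w - 2 edges adjacent to uw have colour κ.

module Submission where

open import Defs

open import Data.Bool using (Bool; true; false; _∧_; _∨_; not; if_then_else_)
import Data.Bool as Bool
open import Data.Bool.Properties using (∧-zeroʳ; ∧-identityʳ; ∨-identityʳ; ∨-zeroʳ; ∨-comm; not-involutive)
open import Data.Fin as Fin using (Fin)
open import Data.Fin.Patterns using (0F; 1F; 2F)
open import Data.Fin.Permutation.Components using (transpose; transpose-inverse)
open import Data.Fin.Properties using (_≟_; toℕ-injective; any?)
open import Data.List using (List; []; _∷_; _++_; map; concatMap; filter; length; allFin; tabulate)
open import Data.List.Membership.Propositional using (_∈_; find; lose)
open import Data.List.Membership.Propositional.Properties using (∈-filter⁻; ∈-allFin)
open import Data.List.Properties using (map-tabulate)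
open import Data.List.Relation.Unary.Any using (here; there)
import Data.List.Relation.Unary.Any as List
open import Data.Nat using (ℕ; suc; _+_; _*_; _≤_; _<_; z≤n; s≤s)
open import Data.Nat.Induction using (<-wellFounded)
open import Data.Nat.Properties hiding (_≟_)
open import Data.Nat.Tactic.RingSolver using (solve-∀)
open import Algebra.Properties.CommutativeSemigroup +-commutativeSemigroup using (interchange; xy∙z≈y∙xz)
open import Data.Product using (Σ; ∃; _×_; _,_; proj₁; proj₂)
open import Function using (_∘_)
open import Induction.WellFounded using (Acc; acc)
open import Relation.Binary.Definitions using (tri<; tri≈; tri>)
open import Relation.Binary.PropositionalEquality
open import Relation.Nullary using (¬_; contradiction)
open import Relation.Nullary.Decidable using (⌊_⌋; yes; no; ⌊⌋-map′)

toℕ : Bool → ℕ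
toℕ false = 0
toℕ true  = 1

infix 8 _²
_² : ℕ → ℕ
n ² = n * n

∧-true⁻ : ∀ {a b} → a ∧ b ≡ true → a ≡ true × b ≡ true
∧-true⁻ {true} {true} _ = refl , refl

toℕ-∧-∨ : ∀ b p q → p ∧ q ≡ false → toℕ (b ∧ (p ∨ q)) ≡ toℕ (p ∧ b) + toℕ (q ∧ b)
toℕ-∧-∨ false true  false _ = refl
toℕ-∧-∨ false false true  _ = refl
toℕ-∧-∨ false false false _ = refl
toℕ-∧-∨ true  true  false _ = refl
toℕ-∧-∨ true  false true  _ = refl
toℕ-∧-∨ true  false false _ = refl

⌊≟⌋-refl : ∀ {k} (i : Fin k) → ⌊ i ≟ i ⌋ ≡ true
⌊≟⌋-refl i = cong ⌊_⌋ (≡-≟-identity _≟_ {i} refl)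

≟-true⇒≡ : ∀ {k} {i j : Fin k} → ⌊ i ≟ j ⌋ ≡ true → i ≡ j
≟-true⇒≡ {i = i} {j} i≟j with i ≟ j
... | yes i≡j = i≡j

≟-disjoint : ∀ {k} {x w : Fin k} → x ≢ w → ∀ y → ⌊ y ≟ x ⌋ ∧ ⌊ y ≟ w ⌋ ≡ false
≟-disjoint {x = x} {w} x≢w y with y ≟ x | y ≟ w
... | yes refl | yes refl = contradiction refl x≢w
... | yes _    | no  _    = refl
... | no  _    | _        = refl

transpose-matchˡ : ∀ {k} (i j : Fin k) → transpose i j i ≡ j
transpose-matchˡ i j rewrite ≡-≟-identity _≟_ {i} refl = refl

transpose-matchʳ : ∀ {k} {i j : Fin k} → i ≢ j → transpose i j j ≡ i
transpose-matchʳ {j = j} i≢j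
  rewrite ≢-≟-identity _≟_ (i≢j ∘ sym) | ≡-≟-identity _≟_ {j} refl = refl

transpose-other : ∀ {k} {i j l : Fin k} → l ≢ i → l ≢ j → transpose i j l ≡ l
transpose-other l≢i l≢j rewrite ≢-≟-identity _≟_ l≢i | ≢-≟-identity _≟_ l≢j = refl

⌊transpose≟⌋ : ∀ {k} (i j a b : Fin k) → ⌊ transpose i j a ≟ b ⌋ ≡ ⌊ a ≟ transpose j i b ⌋
⌊transpose≟⌋ i j a b with transpose i j a ≟ b | a ≟ transpose j i b
... | yes _    | yes _    = refl
... | no  _    | no  _    = refl
... | yes τa≡b | no  a≢τb =
  contradiction (trans (sym (transpose-inverse j i)) (cong (transpose j i) τa≡b)) a≢τb
... | no  τa≢b | yes a≡τb =
  contradiction (trans (cong (transpose i j) a≡τb) (transpose-inverse i j)) τa≢b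

-- Finite sums and counts

module _ {A : Set} where

  ∑ : (A → ℕ) → List A → ℕ
  ∑ f []       = 0
  ∑ f (x ∷ xs) = f x + ∑ f xs

  count : (A → Bool) → List A → ℕ
  count p = ∑ (toℕ ∘ p)

  _∩_ : (A → Bool) → (A → Bool) → A → Bool
  (P ∩ Q) x = P x ∧ Q x

  _∪_ : (A → Bool) → (A → Bool) → A → Bool
  (P ∪ Q) x = P x ∨ Q x

  ∁ : (A → Bool) → A → Bool
  ∁ P x = not (P x)

  ∑-cong : ∀ {f g : A → ℕ} xs → (∀ x → x ∈ xs → f x ≡ g x) → ∑ f xs ≡ ∑ g xs
  ∑-cong []       eq = refl
  ∑-cong (x ∷ xs) eq = cong₂ _+_ (eq x (here refl)) (∑-cong xs (λ y → eq y ∘ there))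

  ∑-distrib-+ : ∀ (f g : A → ℕ) xs → ∑ (λ x → f x + g x) xs ≡ ∑ f xs + ∑ g xs
  ∑-distrib-+ f g []       = refl
  ∑-distrib-+ f g (x ∷ xs) = begin
    f x + g x + ∑ (λ x → f x + g x) xs ≡⟨ cong (f x + g x +_) (∑-distrib-+ f g xs) ⟩
    f x + g x + (∑ f xs + ∑ g xs)      ≡⟨ interchange (f x) (g x) (∑ f xs) (∑ g xs) ⟩
    f x + ∑ f xs + (g x + ∑ g xs)      ∎
    where open ≡-Reasoning

  ∑-mono-≤ : ∀ {f g : A → ℕ} xs → (∀ x → f x ≤ g x) → ∑ f xs ≤ ∑ g xs
  ∑-mono-≤ []       f≤g = z≤n
  ∑-mono-≤ (x ∷ xs) f≤g = +-mono-≤ (f≤g x) (∑-mono-≤ xs f≤g)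

  ∑-mono-< : ∀ {f g : A → ℕ} {xs y} → y ∈ xs → (∀ x → f x ≤ g x) → f y < g y →
             ∑ f xs < ∑ g xs
  ∑-mono-< {xs = _ ∷ xs} (here refl) f≤g fy<gy = +-mono-<-≤ fy<gy (∑-mono-≤ xs f≤g)
  ∑-mono-< (there y∈xs)              f≤g fy<gy = +-mono-≤-< (f≤g _) (∑-mono-< y∈xs f≤g fy<gy)

  ∑-++ : ∀ (f : A → ℕ) xs ys → ∑ f (xs ++ ys) ≡ ∑ f xs + ∑ f ys
  ∑-++ f []       ys = refl
  ∑-++ f (x ∷ xs) ys = trans (cong (f x +_) (∑-++ f xs ys)) (sym (+-assoc (f x) _ _))

  ∑-zero : ∀ (f : A → ℕ) xs → (∀ x → x ∈ xs → f x ≡ 0) → ∑ f xs ≡ 0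
  ∑-zero f []       f≡0 = refl
  ∑-zero f (x ∷ xs) f≡0 = cong₂ _+_ (f≡0 x (here refl)) (∑-zero f xs (λ y → f≡0 y ∘ there))

  ∑-if : ∀ (b : Bool) (f : A → ℕ) xs →
         ∑ (λ x → if b then f x else 0) xs ≡ (if b then ∑ f xs else 0)
  ∑-if true  f xs = refl
  ∑-if false f xs = ∑-zero _ xs (λ _ _ → refl)

  count-∩-< : ∀ {P Q : A → Bool} {xs x} → x ∈ xs → P x ≡ true → Q x ≡ false →
              count (P ∩ Q) xs < count P xs
  count-∩-< {P} {Q} {x = x} x∈xs Px Qx = ∑-mono-< x∈xs (λ y → toℕ-∧-≤ (P y) (Q y)) strict
    where
    toℕ-∧-≤ : ∀ a b → toℕ (a ∧ b) ≤ toℕ a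
    toℕ-∧-≤ false _     = z≤n
    toℕ-∧-≤ true  false = z≤n
    toℕ-∧-≤ true  true  = ≤-refl
    strict : toℕ (P x ∧ Q x) < toℕ (P x)
    strict rewrite Px | Qx = s≤s z≤n

  length-filter≡count : ∀ (p : A → Bool) xs →
                        length (filter (λ x → p x Bool.≟ true) xs) ≡ count p xs
  length-filter≡count p []       = refl
  length-filter≡count p (x ∷ xs) with p x
  ... | true  = cong suc (length-filter≡count p xs)
  ... | false = length-filter≡count p xs

  count-filter : ∀ (q p : A → Bool) xs →
                 count p (filter (λ x → q x Bool.≟ true) xs) ≡ count (λ x → q x ∧ p x) xs
  count-filter q p []       = refl
  count-filter q p (x ∷ xs) with q x
  ... | true  = cong (toℕ (p x) +_) (count-filter q p xs)
  ... | false = count-filter q p xs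

∑-comm : ∀ {A B : Set} (f : A → B → ℕ) xs ys →
         ∑ (λ x → ∑ (f x) ys) xs ≡ ∑ (λ y → ∑ (λ x → f x y) xs) ys
∑-comm f []       ys = sym (∑-zero _ ys (λ _ _ → refl))
∑-comm f (x ∷ xs) ys = trans (cong (∑ (f x) ys +_) (∑-comm f xs ys)) (sym (∑-distrib-+ (f x) _ ys))

∑-map : ∀ {A B : Set} (f : B → ℕ) (g : A → B) xs → ∑ f (map g xs) ≡ ∑ (f ∘ g) xs
∑-map f g []       = refl
∑-map f g (x ∷ xs) = cong (f (g x) +_) (∑-map f g xs)

∑-concatMap : ∀ {A B : Set} (f : B → ℕ) (h : A → List B) xs →
              ∑ f (concatMap h xs) ≡ ∑ (λ x → ∑ f (h x)) xs
∑-concatMap f h []       = refl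
∑-concatMap f h (x ∷ xs) = trans (∑-++ f (h x) _) (cong (∑ f (h x) +_) (∑-concatMap f h xs))

∑ᶠ : ∀ {k} → (Fin k → ℕ) → ℕ
∑ᶠ f = ∑ f (allFin _)

∑ᶠ-suc : ∀ {k} (f : Fin (suc k) → ℕ) → ∑ᶠ f ≡ f Fin.zero + ∑ᶠ {k} (f ∘ Fin.suc)
∑ᶠ-suc {k} f = cong (f Fin.zero +_) (begin
  ∑ f (tabulate Fin.suc)         ≡⟨ cong (∑ f) (map-tabulate (λ i → i) Fin.suc) ⟨
  ∑ f (map Fin.suc (allFin k))   ≡⟨ ∑-map f Fin.suc (allFin k) ⟩
  ∑ (f ∘ Fin.suc) (allFin k)     ∎)
  where open ≡-Reasoning

∑-δ : ∀ {k} (a : Fin k) (f : Fin k → ℕ) → ∑ᶠ (λ i → if ⌊ a ≟ i ⌋ then f i else 0) ≡ f a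
∑-δ {suc k} Fin.zero f = begin
  ∑ᶠ (λ i → if ⌊ Fin.zero ≟ i ⌋ then f i else 0)
    ≡⟨ ∑ᶠ-suc (λ i → if ⌊ Fin.zero ≟ i ⌋ then f i else 0) ⟩
  f Fin.zero + ∑ᶠ {k} (λ _ → 0)
    ≡⟨ cong (f Fin.zero +_) (∑-zero _ (allFin k) (λ _ _ → refl)) ⟩
  f Fin.zero + 0
    ≡⟨ +-identityʳ (f Fin.zero) ⟩
  f Fin.zero
    ∎
  where open ≡-Reasoning
∑-δ {suc k} (Fin.suc a) f = begin
  ∑ᶠ (λ i → if ⌊ Fin.suc a ≟ i ⌋ then f i else 0)
    ≡⟨ ∑ᶠ-suc (λ i → if ⌊ Fin.suc a ≟ i ⌋ then f i else 0) ⟩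
  ∑ᶠ (λ i → if ⌊ Fin.suc a ≟ Fin.suc i ⌋ then f (Fin.suc i) else 0)
    ≡⟨ ∑-cong (allFin k) (λ i _ → cong (if_then f (Fin.suc i) else 0) (⌊⌋-map′ _ _ (a ≟ i))) ⟩
  ∑ᶠ (λ i → if ⌊ a ≟ i ⌋ then f (Fin.suc i) else 0)
    ≡⟨ ∑-δ a (f ∘ Fin.suc) ⟩
  f (Fin.suc a)
    ∎
  where open ≡-Reasoning

erase : ∀ {k} → Fin k → (Fin k → ℕ) → Fin k → ℕ
erase a f i = if ⌊ a ≟ i ⌋ then 0 else f i

∑-erase : ∀ {k} (a : Fin k) (f : Fin k → ℕ) → ∑ᶠ f ≡ f a + ∑ᶠ (erase a f)
∑-erase {k} a f = begin
  ∑ᶠ f                                                       ≡⟨ ∑-cong (allFin k) (λ i _ → split i) ⟩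
  ∑ᶠ (λ i → (if ⌊ a ≟ i ⌋ then f i else 0) + erase a f i)   ≡⟨ ∑-distrib-+ _ _ (allFin k) ⟩
  ∑ᶠ (λ i → if ⌊ a ≟ i ⌋ then f i else 0) + ∑ᶠ (erase a f)  ≡⟨ cong (_+ ∑ᶠ (erase a f)) (∑-δ a f) ⟩
  f a + ∑ᶠ (erase a f)                                       ∎
  where
  open ≡-Reasoning
  split : ∀ i → f i ≡ (if ⌊ a ≟ i ⌋ then f i else 0) + erase a f i
  split i with ⌊ a ≟ i ⌋
  ... | true  = sym (+-identityʳ (f i))
  ... | false = refl

module _ {k : ℕ} {α β : Fin k} (α≢β : α ≢ β) where

  ∑-erase₂ : ∀ (f : Fin k → ℕ) → ∑ᶠ f ≡ f α + f β + ∑ᶠ (erase β (erase α f))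
  ∑-erase₂ f = begin
    ∑ᶠ f                                             ≡⟨ ∑-erase α f ⟩
    f α + ∑ᶠ (erase α f)                             ≡⟨ cong (f α +_) (∑-erase β (erase α f)) ⟩
    f α + (erase α f β + ∑ᶠ (erase β (erase α f)))   ≡⟨ cong (λ t → f α + (t + rest)) erase-β ⟩
    f α + (f β + ∑ᶠ (erase β (erase α f)))           ≡⟨ +-assoc (f α) (f β) _ ⟨
    f α + f β + ∑ᶠ (erase β (erase α f))             ∎
    where
    open ≡-Reasoning
    rest = ∑ᶠ (erase β (erase α f))
    erase-β : erase α f β ≡ f β
    erase-β with α ≟ β
    ... | yes α≡β = contradiction α≡β α≢β
    ... | no  _   = refl

  ∑-exchange : ∀ {f g : Fin k → ℕ} {m} → (∀ i → i ≢ α → i ≢ β → f i ≡ g i) →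
               m + (f α + f β) ≤ g α + g β → m + ∑ᶠ f ≤ ∑ᶠ g
  ∑-exchange {f} {g} {m} f≡g m+fαβ≤gαβ = begin
    m + ∑ᶠ f                                      ≡⟨ cong (m +_) (∑-erase₂ f) ⟩
    m + (f α + f β + ∑ᶠ (erase β (erase α f)))    ≡⟨ +-assoc m (f α + f β) _ ⟨
    m + (f α + f β) + ∑ᶠ (erase β (erase α f))    ≤⟨ +-monoˡ-≤ _ m+fαβ≤gαβ ⟩
    g α + g β + ∑ᶠ (erase β (erase α f))          ≡⟨ cong (g α + g β +_) (∑-cong (allFin k) (λ i _ → erased i)) ⟩
    g α + g β + ∑ᶠ (erase β (erase α g))          ≡⟨ ∑-erase₂ g ⟨
    ∑ᶠ g                                          ∎
    where
    open ≤-Reasoning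
    erased : ∀ i → erase β (erase α f) i ≡ erase β (erase α g) i
    erased i with β ≟ i | α ≟ i
    ... | yes _   | _       = refl
    ... | no  _   | yes _   = refl
    ... | no  β≢i | no  α≢i = f≡g i (α≢i ∘ sym) (β≢i ∘ sym)

-- Edges of a simple graph

module _ (G : Graph) where
  open Graph G using (n; adj) renaming (sym to adj-sym; irrefl to adj-irrefl)

  allPairs : List (Pair G)
  allPairs = concatMap (λ u → map (λ w → (u , w)) (allFin n)) (allFin n)

  incident : Fin n → Pair G → Bool
  incident y (u , w) = ⌊ y ≟ u ⌋ ∨ ⌊ y ≟ w ⌋

  degreeIn : (Pair G → Bool) → Fin n → ℕ
  degreeIn P y = count (λ f → P f ∧ incident y f) (edges G)

  ∑-allPairs : ∀ (f : Pair G → ℕ) → ∑ f allPairs ≡ ∑ᶠ (λ u → ∑ᶠ (λ w → f (u , w)))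
  ∑-allPairs f = trans (∑-concatMap f _ (allFin n)) (∑-cong (allFin n) (λ u _ → ∑-map f (u ,_) (allFin n)))

  count-edges : ∀ (p : Pair G → Bool) →
                count p (edges G) ≡ ∑ᶠ (λ u → ∑ᶠ (λ w → toℕ (isEdge G (u , w) ∧ p (u , w))))
  count-edges p = trans (count-filter (isEdge G) p allPairs) (∑-allPairs _)

  ∈-edges⇒isEdge : ∀ {e} → e ∈ edges G → isEdge G e ≡ true
  ∈-edges⇒isEdge e∈ = proj₂ (∈-filter⁻ (λ e → isEdge G e Bool.≟ true) {xs = allPairs} e∈)

  isEdge⇒< : ∀ {u w} → isEdge G (u , w) ≡ true → Fin.toℕ u < Fin.toℕ w
  isEdge⇒< {u} {w} uw with Fin.toℕ u <? Fin.toℕ w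
  ... | yes u<w = u<w

  <⇒isEdge≡adj : ∀ {u w} → Fin.toℕ u < Fin.toℕ w → isEdge G (u , w) ≡ adj u w
  <⇒isEdge≡adj {u} {w} u<w with Fin.toℕ u <? Fin.toℕ w
  ... | yes _   = refl
  ... | no  u≮w = contradiction u<w u≮w

  ≮⇒isEdge≡false : ∀ {u w} → ¬ Fin.toℕ u < Fin.toℕ w → isEdge G (u , w) ≡ false
  ≮⇒isEdge≡false {u} {w} u≮w with Fin.toℕ u <? Fin.toℕ w
  ... | yes u<w = contradiction u<w u≮w
  ... | no  _   = refl

  adj≡isEdge+isEdge : ∀ y w → toℕ (adj y w) ≡ toℕ (isEdge G (y , w)) + toℕ (isEdge G (w , y))
  adj≡isEdge+isEdge y w with <-cmp (Fin.toℕ y) (Fin.toℕ w)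
  ... | tri< y<w _ w≮y rewrite <⇒isEdge≡adj y<w | ≮⇒isEdge≡false w≮y = sym (+-identityʳ _)
  ... | tri> y≮w _ w<y rewrite <⇒isEdge≡adj w<y | ≮⇒isEdge≡false y≮w = cong toℕ (adj-sym y w)
  ... | tri≈ y≮w y≡w _ with toℕ-injective y≡w
  ...   | refl rewrite ≮⇒isEdge≡false y≮w | adj-irrefl y = refl

  count-incident≡degree : ∀ y → count (incident y) (edges G) ≡ degree G y
  count-incident≡degree y = begin
    count (incident y) (edges G)
      ≡⟨ count-edges (incident y) ⟩
    ∑ᶠ (λ u → ∑ᶠ (λ w → toℕ (isEdge G (u , w) ∧ incident y (u , w))))
      ≡⟨ ∑-cong (allFin n) (λ u _ → trans (∑-cong (allFin n) (λ w _ → by-endpoint u w)) (∑-distrib-+ _ _ (allFin n))) ⟩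
    ∑ᶠ (λ u → ∑ᶠ (as-first u) + ∑ᶠ (as-second u))
      ≡⟨ ∑-distrib-+ _ _ (allFin n) ⟩
    ∑ᶠ (λ u → ∑ᶠ (as-first u)) + ∑ᶠ (λ u → ∑ᶠ (as-second u))
      ≡⟨ cong₂ _+_ (trans (∑-cong (allFin n) (λ u _ → ∑-if ⌊ y ≟ u ⌋ (edge u) (allFin n))) (∑-δ y (λ u → ∑ᶠ (edge u))))
                   (∑-cong (allFin n) (λ u _ → ∑-δ y (edge u))) ⟩
    ∑ᶠ (edge y) + ∑ᶠ (λ u → edge u y)
      ≡⟨ ∑-distrib-+ (edge y) (λ u → edge u y) (allFin n) ⟨
    ∑ᶠ (λ w → edge y w + edge w y)
      ≡⟨ ∑-cong (allFin n) (λ w _ → adj≡isEdge+isEdge y w) ⟨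
    count (adj y) (allFin n)
      ≡⟨ length-filter≡count (adj y) (allFin n) ⟨
    degree G y
      ∎
    where
    open ≡-Reasoning
    edge as-first as-second : Fin n → Fin n → ℕ
    edge u w = toℕ (isEdge G (u , w))
    as-first u w = if ⌊ y ≟ u ⌋ then edge u w else 0
    as-second u w = if ⌊ y ≟ w ⌋ then edge u w else 0
    by-endpoint : ∀ u w → toℕ (isEdge G (u , w) ∧ incident y (u , w)) ≡ as-first u w + as-second u w
    by-endpoint u w with y ≟ u | y ≟ w
    ... | yes refl | yes refl rewrite ≮⇒isEdge≡false (<-irrefl {Fin.toℕ y} refl) = refl
    ... | yes refl | no  _    rewrite ∧-identityʳ (isEdge G (y , w)) = sym (+-identityʳ _)
    ... | no  _    | yes refl rewrite ∧-identityʳ (isEdge G (u , y)) = refl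
    ... | no  _    | no  _    rewrite ∧-zeroʳ (isEdge G (u , w)) = refl

  sameEdge⇒≡ : ∀ {e f} → sameEdge G e f ≡ true → e ≡ f
  sameEdge⇒≡ {a , b} {u , w} same with a ≟ u | b ≟ w
  ... | yes refl | yes refl = refl

  sameEdge-refl : ∀ e → sameEdge G e e ≡ true
  sameEdge-refl (a , b) with a ≟ a | b ≟ b
  ... | yes _   | yes _   = refl
  ... | no  a≢a | _       = contradiction refl a≢a
  ... | yes _   | no  b≢b = contradiction refl b≢b

  count-sameEdge : ∀ {e} → isEdge G e ≡ true → (Q : Pair G → Bool) →
                   count (λ f → sameEdge G e f ∧ Q f) (edges G) ≡ toℕ (Q e)
  count-sameEdge {a , b} e∈G Q = begin
    count (λ f → sameEdge G (a , b) f ∧ Q f) (edges G)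
      ≡⟨ count-edges _ ⟩
    ∑ᶠ (λ u → ∑ᶠ (λ w → toℕ (isEdge G (u , w) ∧ (sameEdge G (a , b) (u , w) ∧ Q (u , w)))))
      ≡⟨ ∑-cong (allFin n) (λ u _ → row u) ⟩
    ∑ᶠ (λ u → if ⌊ a ≟ u ⌋ then ∑ᶠ (λ w → if ⌊ b ≟ w ⌋ then toℕ (Q (u , w)) else 0) else 0)
      ≡⟨ ∑-δ a _ ⟩
    ∑ᶠ (λ w → if ⌊ b ≟ w ⌋ then toℕ (Q (a , w)) else 0)
      ≡⟨ ∑-δ b _ ⟩
    toℕ (Q (a , b))
      ∎
    where
    open ≡-Reasoning
    row : ∀ u → ∑ᶠ (λ w → toℕ (isEdge G (u , w) ∧ (sameEdge G (a , b) (u , w) ∧ Q (u , w))))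
              ≡ (if ⌊ a ≟ u ⌋ then ∑ᶠ (λ w → if ⌊ b ≟ w ⌋ then toℕ (Q (u , w)) else 0) else 0)
    row u with a ≟ u
    ... | no  _    = ∑-zero _ (allFin n) (λ w _ → cong toℕ (∧-zeroʳ (isEdge G (u , w))))
    ... | yes refl = ∑-cong (allFin n) entry
      where
      entry : ∀ w → w ∈ allFin n →
              toℕ (isEdge G (a , w) ∧ (⌊ b ≟ w ⌋ ∧ Q (a , w))) ≡ (if ⌊ b ≟ w ⌋ then toℕ (Q (a , w)) else 0)
      entry w _ with b ≟ w
      ... | yes refl rewrite e∈G = refl
      ... | no  _    rewrite ∧-zeroʳ (isEdge G (a , w)) = refl

  adjacent+same+same : ∀ {u w x y} → Fin.toℕ u < Fin.toℕ w → Fin.toℕ x < Fin.toℕ y →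
                       toℕ (adjacentEdges G (u , w) (x , y)) + toℕ (sameEdge G (u , w) (x , y))
                                                             + toℕ (sameEdge G (u , w) (x , y))
                         ≡ toℕ (incident u (x , y)) + toℕ (incident w (x , y))
  adjacent+same+same {u} {w} {x} {y} u<w x<y with u ≟ x | u ≟ y | w ≟ x | w ≟ y
  ... | yes refl | yes refl | _        | _        = contradiction x<y (<-irrefl refl)
  ... | _        | _        | yes refl | yes refl = contradiction x<y (<-irrefl refl)
  ... | yes refl | _        | yes refl | _        = contradiction u<w (<-irrefl refl)
  ... | _        | yes refl | _        | yes refl = contradiction u<w (<-irrefl refl)
  ... | _        | yes refl | yes refl | _        = contradiction u<w (<-asym x<y)
  ... | yes refl | no  _    | no  _    | yes refl = refl
  ... | yes refl | no  _    | no  _    | no  _    = refl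
  ... | no  _    | yes refl | no  _    | no  _    = refl
  ... | no  _    | no  _    | yes refl | no  _    = refl
  ... | no  _    | no  _    | no  _    | yes refl = refl
  ... | no  _    | no  _    | no  _    | no  _    = refl

  count-adjacent : ∀ {u w} → isEdge G (u , w) ≡ true → (Q : Pair G → Bool) →
    count (λ f → adjacentEdges G (u , w) f ∧ Q f) (edges G) + toℕ (Q (u , w)) + toℕ (Q (u , w))
      ≡ degreeIn Q u + degreeIn Q w
  count-adjacent {u} {w} uw∈G Q = begin
    count (λ f → adjacentEdges G (u , w) f ∧ Q f) (edges G) + toℕ (Q (u , w)) + toℕ (Q (u , w))
      ≡⟨ cong₂ (λ s t → count (λ f → adjacentEdges G (u , w) f ∧ Q f) (edges G) + s + t)
               (count-sameEdge uw∈G Q) (count-sameEdge uw∈G Q) ⟨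
    count (λ f → adjacentEdges G (u , w) f ∧ Q f) (edges G) + count same∧Q (edges G) + count same∧Q (edges G)
      ≡⟨ cong (_+ count same∧Q (edges G)) (∑-distrib-+ _ _ (edges G)) ⟨
    ∑ (λ f → toℕ (adjacentEdges G (u , w) f ∧ Q f) + toℕ (same∧Q f)) (edges G) + count same∧Q (edges G)
      ≡⟨ ∑-distrib-+ _ _ (edges G) ⟨
    ∑ (λ f → toℕ (adjacentEdges G (u , w) f ∧ Q f) + toℕ (same∧Q f) + toℕ (same∧Q f)) (edges G)
      ≡⟨ ∑-cong (edges G) (λ f f∈G → restrict f (isEdge⇒< (∈-edges⇒isEdge f∈G))) ⟩
    ∑ (λ f → toℕ (Q f ∧ incident u f) + toℕ (Q f ∧ incident w f)) (edges G)
      ≡⟨ ∑-distrib-+ _ _ (edges G) ⟩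
    degreeIn Q u + degreeIn Q w
      ∎
    where
    open ≡-Reasoning
    same∧Q : Pair G → Bool
    same∧Q f = sameEdge G (u , w) f ∧ Q f
    restrict : ∀ ((x , y) : Pair G) → Fin.toℕ x < Fin.toℕ y →
               toℕ (adjacentEdges G (u , w) (x , y) ∧ Q (x , y)) + toℕ (same∧Q (x , y)) + toℕ (same∧Q (x , y))
                 ≡ toℕ (Q (x , y) ∧ incident u (x , y)) + toℕ (Q (x , y) ∧ incident w (x , y))
    restrict (x , y) x<y with Q (x , y) | adjacent+same+same (isEdge⇒< uw∈G) x<y
    ... | true  | eq rewrite ∧-identityʳ (adjacentEdges G (u , w) (x , y))
                           | ∧-identityʳ (sameEdge G (u , w) (x , y)) = eq
    ... | false | _  rewrite ∧-zeroʳ (adjacentEdges G (u , w) (x , y))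
                           | ∧-zeroʳ (sameEdge G (u , w) (x , y)) = refl

  other-endpoint : ∀ {e x} → isEdge G e ≡ true → incident x e ≡ true →
                   ∃ λ w → x ≢ w × (∀ y → incident y e ≡ ⌊ y ≟ x ⌋ ∨ ⌊ y ≟ w ⌋)
  other-endpoint {u , w} {x} uw∈G x∈e with x ≟ u | x ≟ w
  ... | yes refl | _        = w , (λ { refl → <-irrefl refl (isEdge⇒< uw∈G) }) , (λ y → refl)
  ... | no  x≢u  | yes refl = u , x≢u , (λ y → ∨-comm ⌊ y ≟ u ⌋ ⌊ y ≟ x ⌋)

  degreeIn-cong : ∀ {P Q} → (∀ f → P f ≡ Q f) → ∀ y → degreeIn P y ≡ degreeIn Q y
  degreeIn-cong P≡Q y = ∑-cong (edges G) (λ f _ → cong (λ b → toℕ (b ∧ incident y f)) (P≡Q f))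

  degreeIn-split : ∀ S P y → degreeIn P y ≡ degreeIn (S ∩ P) y + degreeIn (∁ S ∩ P) y
  degreeIn-split S P y = trans (∑-cong (edges G) (λ f _ → by-S f)) (∑-distrib-+ _ _ (edges G))
    where
    by-S : ∀ f → toℕ (P f ∧ incident y f)
                 ≡ toℕ ((S ∩ P) f ∧ incident y f) + toℕ ((∁ S ∩ P) f ∧ incident y f)
    by-S f with S f
    ... | true  = sym (+-identityʳ _)
    ... | false = refl

  degreeIn-insert : ∀ {S e} → isEdge G e ≡ true → S e ≡ false → ∀ P y →
                    degreeIn ((S ∪ sameEdge G e) ∩ P) y ≡ degreeIn (S ∩ P) y + toℕ (P e ∧ incident y e)
  degreeIn-insert {S} {e} e∈G e∉S P y = begin
    degreeIn ((S ∪ sameEdge G e) ∩ P) y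
      ≡⟨ ∑-cong (edges G) (λ f _ → by-e f) ⟩
    ∑ (λ f → toℕ ((S ∩ P) f ∧ incident y f) + toℕ (sameEdge G e f ∧ (P f ∧ incident y f))) (edges G)
      ≡⟨ ∑-distrib-+ _ _ (edges G) ⟩
    degreeIn (S ∩ P) y + count (λ f → sameEdge G e f ∧ (P f ∧ incident y f)) (edges G)
      ≡⟨ cong (degreeIn (S ∩ P) y +_) (count-sameEdge e∈G (λ f → P f ∧ incident y f)) ⟩
    degreeIn (S ∩ P) y + toℕ (P e ∧ incident y e)
      ∎
    where
    open ≡-Reasoning
    by-e : ∀ f → toℕ (((S ∪ sameEdge G e) ∩ P) f ∧ incident y f)
                 ≡ toℕ ((S ∩ P) f ∧ incident y f) + toℕ (sameEdge G e f ∧ (P f ∧ incident y f))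
    by-e f with sameEdge G e f in e≡f?
    ... | false rewrite ∨-identityʳ (S f) = sym (+-identityʳ _)
    ... | true with sameEdge⇒≡ {e} {f} e≡f?
    ...   | refl rewrite e∉S = refl

-- Alternating trails and balanced colourings

square-exchange : ∀ d s p q → (s + p) ² + (d + s + q) ² + 2 * d * p ≡ (d + s + p) ² + (s + q) ² + 2 * d * q
square-exchange = expanded
  where
  -- the ring solver does not unfold _²
  expanded : ∀ d s p q → (s + p) * (s + p) + (d + s + q) * (d + s + q) + 2 * d * p
                         ≡ (d + s + p) * (d + s + p) + (s + q) * (s + q) + 2 * d * q
  expanded = solve-∀

square-exchange-≤ : ∀ d s p q m → m + 2 * d * q ≤ 2 * d * p →
                    m + ((s + p) ² + (d + s + q) ²) ≤ (d + s + p) ² + (s + q) ²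
square-exchange-≤ d s p q m slack = +-cancelʳ-≤ (2 * d * q) _ _ (begin
  m + ((s + p) ² + (d + s + q) ²) + 2 * d * q   ≡⟨ xy∙z≈y∙xz m _ (2 * d * q) ⟩
  (s + p) ² + (d + s + q) ² + (m + 2 * d * q)   ≤⟨ +-monoʳ-≤ ((s + p) ² + (d + s + q) ²) slack ⟩
  (s + p) ² + (d + s + q) ² + 2 * d * p         ≡⟨ square-exchange d s p q ⟩
  (d + s + p) ² + (s + q) ² + 2 * d * q         ∎)
  where open ≤-Reasoning

cancel-middle : ∀ a s b {c} → a + s + b ≤ s + c → a + b ≤ c
cancel-middle a s b {c} h = +-cancelˡ-≤ s (a + b) c (subst (_≤ s + c) (xy∙z≈y∙xz a s b) h)

-- At a vertex y, with sA, sB its α-, β-degrees inside the trail and pA, pB outside it, swapping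
-- the trail's colours lowers the sum of squares by 2 (sA - sB) (pA - pB).  Y and Z say whether y
-- starts or ends the trail (μ being the colour that would continue it); the balance law of the
-- trail leaves only sA - sB ∈ {0, ±1, 2}.
exchange-at-vertex : ∀ {sA sB pA pB} μ Z Y →
  toℕ (Z ∧ μ) + toℕ (Y ∧ false) + sA ≡ toℕ (Z ∧ not μ) + toℕ (Y ∧ true) + sB →
  (Z ∧ μ ≡ true → pA ≡ 0) → (Z ∧ not μ ≡ true → pB ≡ 0) →
  (Y ≡ true → 3 + sB + pB ≤ sA + pA) →
  toℕ Y + ((sB + pA) ² + (sA + pB) ²) ≤ (sA + pA) ² + (sB + pB) ²
exchange-at-vertex μ false false refl _ _ _ = ≤-refl
exchange-at-vertex {sB = sB} {pA} {pB} μ false true refl _ _ imbalanced =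
  square-exchange-≤ 1 sB pA pB 1 (slack (cancel-middle 2 sB pB (≤-pred (imbalanced refl))))
  where
  slack : ∀ {p q} → 2 + q ≤ p → 1 + 2 * q ≤ 2 * p
  slack {p} {q} 2+q≤p = begin
    1 + 2 * q       ≤⟨ +-monoˡ-≤ (2 * q) (s≤s {0} {3} z≤n) ⟩
    2 * 2 + 2 * q   ≡⟨ *-distribˡ-+ 2 2 q ⟨
    2 * (2 + q)     ≤⟨ *-monoʳ-≤ 2 2+q≤p ⟩
    2 * p           ∎
    where open ≤-Reasoning
exchange-at-vertex {sA} {pB = pB} true true false refl empty-α _ _ with empty-α refl
... | refl = subst₂ _≤_ (+-comm ((sA + pB) ²) _) (+-comm ((suc sA + pB) ²) _)
                     (square-exchange-≤ 1 sA pB 0 0 z≤n)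
exchange-at-vertex {sB = sB} {pA} false true false refl _ empty-β _ with empty-β refl
... | refl = square-exchange-≤ 1 sB pA 0 0 z≤n
exchange-at-vertex {sA} {pB = pB} true true true refl empty-α _ imbalanced with empty-α refl
... | refl = contradiction (cancel-middle 3 sA pB (imbalanced refl)) λ ()
exchange-at-vertex {sB = sB} {pA} false true true refl _ empty-β imbalanced with empty-β refl
... | refl = square-exchange-≤ 2 sB pA 0 1
               (≤-trans (cancel-middle 1 sB 0 (≤-pred (≤-pred (imbalanced refl)))) (m≤n*m pA 4))

module _ (G : Graph) {k : ℕ} where
  open Graph G using (n)

  painted : EdgeColouring G k → Fin k → Pair G → Bool
  painted c κ f = ⌊ c f ≟ κ ⌋

  colourDegree : EdgeColouring G k → Fin n → Fin k → ℕ
  colourDegree c y κ = degreeIn G (painted c κ) y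

  potentialAt : EdgeColouring G k → Fin n → ℕ
  potentialAt c y = ∑ᶠ (λ κ → colourDegree c y κ ²)

  potential : EdgeColouring G k → ℕ
  potential c = ∑ᶠ (potentialAt c)

  Balanced : EdgeColouring G k → Set
  Balanced c = ∀ y α β → colourDegree c y α ≤ 2 + colourDegree c y β

  module _ (c : EdgeColouring G k) {α β : Fin k} (α≢β : α ≢ β) where

    colour : Bool → Fin k
    colour b = if b then α else β

    painted-colour : ∀ b {f} → painted c (colour b) f ≡ true →
                     painted c α f ≡ b × painted c β f ≡ not b
    painted-colour true  f∈α with ≟-true⇒≡ f∈α
    ... | c≡α rewrite c≡α | ≡-≟-identity _≟_ {α} refl | ≢-≟-identity _≟_ α≢β = refl , refl
    painted-colour false f∈β with ≟-true⇒≡ f∈β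
    ... | c≡β rewrite c≡β | ≡-≟-identity _≟_ {β} refl | ≢-≟-identity _≟_ (α≢β ∘ sym) = refl , refl

    pin : Fin n → Bool → Fin n → ℕ
    pin x b y = toℕ (⌊ y ≟ x ⌋ ∧ b)

    continues : (Pair G → Bool) → Fin n → Bool → Pair G → Bool
    continues R x b = R ∩ (painted c (colour b) ∩ incident G x)

    -- A trail from x whose first edge has colour b (true for α, false for β), given by its edge
    -- set S ⊆ R; next is the colour in which it would continue at end.  The balance law says that
    -- S plus a half-edge of colour not b at x and one of colour next at end has as many α- as
    -- β-edges at every vertex (pin z a y is 1 iff y = z and a; α-pins are on the left).
    record Trail (R : Pair G → Bool) (x : Fin n) (b : Bool) : Set where
      field
        S       : Pair G → Bool
        S⊆R     : ∀ f → S f ≡ true → R f ≡ true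
        end     : Fin n
        next    : Bool
        balance : ∀ y → pin end next y + pin x (not b) y + degreeIn G (S ∩ painted c α) y
                      ≡ pin end (not next) y + pin x b y + degreeIn G (S ∩ painted c β) y
        maximal : ∀ f → f ∈ edges G → continues R end next f ≡ true → S f ≡ true

    extend : ∀ {R x b e} → e ∈ edges G → continues R x b e ≡ true →
             (∀ w → Trail (R ∩ ∁ (sameEdge G e)) w (not b)) → Trail R x b
    extend {R} {x} {b} {e} e∈G e-continues trail-from
      with ∧-true⁻ e-continues
    ... | e∈R , e-painted-x∈e
      with ∧-true⁻ e-painted-x∈e
    ... | e-painted , x∈e
      with other-endpoint G {e} {x} (∈-edges⇒isEdge G e∈G) x∈e
    ... | w , x≢w , e-ends = record
      { S = S′ ∪ sameEdge G e ; S⊆R = S⊆R ; end = end ; next = next ; balance = balance ; maximal = maximal }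
      where
      open Trail (trail-from w) renaming (S to S′; S⊆R to S′⊆R′; balance to balance′; maximal to maximal′)

      e∉S′ : S′ e ≡ false
      e∉S′ with S′ e in e∈S′
      ... | false = refl
      ... | true  = contradiction e∈R′ λ ()
        where
        e∈R′ : true ≡ false
        e∈R′ = trans (sym (S′⊆R′ e e∈S′))
                     (trans (cong (λ s → R e ∧ not s) (sameEdge-refl G e)) (∧-zeroʳ (R e)))

      S⊆R : ∀ f → (S′ ∪ sameEdge G e) f ≡ true → R f ≡ true
      S⊆R f f∈S with S′ f in f∈S′
      ... | true  = proj₁ (∧-true⁻ (S′⊆R′ f f∈S′))
      ... | false with sameEdge⇒≡ G {e} {f} f∈S
      ...   | refl = e∈R

      insert-e : ∀ κ {b′} → painted c κ e ≡ b′ → ∀ y →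
                 degreeIn G ((S′ ∪ sameEdge G e) ∩ painted c κ) y
                   ≡ degreeIn G (S′ ∩ painted c κ) y + (pin x b′ y + pin w b′ y)
      insert-e κ {b′} e-κ y = trans (degreeIn-insert G (∈-edges⇒isEdge G e∈G) e∉S′ (painted c κ) y)
                                    (cong (degreeIn G (S′ ∩ painted c κ) y +_) e-at)
        where
        e-at : toℕ (painted c κ e ∧ incident G y e) ≡ pin x b′ y + pin w b′ y
        e-at rewrite e-κ | e-ends y = toℕ-∧-∨ b′ ⌊ y ≟ x ⌋ ⌊ y ≟ w ⌋ (≟-disjoint x≢w y)

      balance : ∀ y → pin end next y + pin x (not b) y + degreeIn G ((S′ ∪ sameEdge G e) ∩ painted c α) y
                    ≡ pin end (not next) y + pin x b y + degreeIn G ((S′ ∪ sameEdge G e) ∩ painted c β) y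
      balance y = begin
        pin end next y + pin x (not b) y + degreeIn G ((S′ ∪ sameEdge G e) ∩ painted c α) y
          ≡⟨ cong (pin end next y + pin x (not b) y +_) (insert-e α (proj₁ e-colours) y) ⟩
        pin end next y + pin x (not b) y + (A′ + (pin x b y + pin w b y))
          ≡⟨ regroupˡ (pin end next y) (pin x (not b) y) A′ (pin x b y) (pin w b y) ⟩
        pin end next y + pin w b y + A′ + (pin x (not b) y + pin x b y)
          ≡⟨ cong (_+ (pin x (not b) y + pin x b y)) balance″ ⟩
        pin end (not next) y + pin w (not b) y + B′ + (pin x (not b) y + pin x b y)
          ≡⟨ regroupʳ (pin end (not next) y) (pin w (not b) y) B′ (pin x (not b) y) (pin x b y) ⟩
        pin end (not next) y + pin x b y + (B′ + (pin x (not b) y + pin w (not b) y))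
          ≡⟨ cong (pin end (not next) y + pin x b y +_) (insert-e β (proj₂ e-colours) y) ⟨
        pin end (not next) y + pin x b y + degreeIn G ((S′ ∪ sameEdge G e) ∩ painted c β) y
          ∎
        where
        open ≡-Reasoning
        A′ = degreeIn G (S′ ∩ painted c α) y
        B′ = degreeIn G (S′ ∩ painted c β) y
        e-colours : painted c α e ≡ b × painted c β e ≡ not b
        e-colours = painted-colour b e-painted
        balance″ : pin end next y + pin w b y + A′ ≡ pin end (not next) y + pin w (not b) y + B′
        balance″ = subst (λ b″ → pin end next y + pin w b″ y + A′ ≡ pin end (not next) y + pin w (not b) y + B′)
                         (not-involutive b) (balance′ y)
        regroupˡ : ∀ z x¬ a xb wb → z + x¬ + (a + (xb + wb)) ≡ z + wb + a + (x¬ + xb)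
        regroupˡ = solve-∀
        regroupʳ : ∀ z w¬ b x¬ xb → z + w¬ + b + (x¬ + xb) ≡ z + xb + (b + (x¬ + w¬))
        regroupʳ = solve-∀

      maximal : ∀ f → f ∈ edges G → continues R end next f ≡ true → (S′ ∪ sameEdge G e) f ≡ true
      maximal f f∈G f-continues with sameEdge G e f in e≢f
      ... | true  = ∨-zeroʳ (S′ f)
      ... | false = trans (∨-identityʳ (S′ f)) (maximal′ f f∈G f-continues′)
        where
        f-continues′ : continues (R ∩ ∁ (sameEdge G e)) end next f ≡ true
        f-continues′ rewrite e≢f | ∧-identityʳ (R f) = f-continues

    trail : ∀ R → Acc _<_ (count R (edges G)) → ∀ x b → Trail R x b
    trail R (acc smaller) x b with List.any? (λ f → continues R x b f Bool.≟ true) (edges G)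
    ... | no  stuck = record
      { S = λ _ → false ; S⊆R = λ _ () ; end = x ; next = b
      ; balance = λ y → cong (_+ degreeIn G ((λ _ → false) ∩ painted c α) y)
                             (+-comm (pin x b y) (pin x (not b) y))
      ; maximal = λ f f∈G f-continues → contradiction (lose f∈G f-continues) stuck
      }
    ... | yes some with find some
    ...   | e , e∈G , e-continues =
      extend e∈G e-continues (λ w → trail (R ∩ ∁ (sameEdge G e)) (smaller e-removed) w (not b))
      where
      e-removed : count (R ∩ ∁ (sameEdge G e)) (edges G) < count R (edges G)
      e-removed = count-∩-< e∈G (proj₁ (∧-true⁻ e-continues)) (cong not (sameEdge-refl G e))

    unused-at-end : ∀ {R x b} (t : Trail R x b) →
                    degreeIn G ((R ∩ ∁ (Trail.S t)) ∩ painted c (colour (Trail.next t))) (Trail.end t) ≡ 0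
    unused-at-end {R} t = ∑-zero _ (edges G) (λ f f∈G → cong toℕ (unused (R f) (S f) _ _ (maximal f f∈G)))
      where
      open Trail t
      unused : ∀ r s p i → (r ∧ (p ∧ i) ≡ true → s ≡ true) → ((r ∧ not s) ∧ p) ∧ i ≡ false
      unused false s     p     i     _ = refl
      unused true  true  p     i     _ = refl
      unused true  false false i     _ = refl
      unused true  false true  false _ = refl
      unused true  false true  true  h = contradiction (h refl) λ ()

    swapped : (Pair G → Bool) → EdgeColouring G k
    swapped S f = if S f then transpose α β (c f) else c f

    colourDegree-swapped : ∀ S y κ → colourDegree (swapped S) y κ
                                     ≡ degreeIn G (S ∩ painted c (transpose β α κ)) y + degreeIn G (∁ S ∩ painted c κ) y
    colourDegree-swapped S y κ = trans (degreeIn-split G S (painted (swapped S) κ) y)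
                                       (cong₂ _+_ (degreeIn-cong G inside y) (degreeIn-cong G outside y))
      where
      inside : ∀ f → (S ∩ painted (swapped S) κ) f ≡ (S ∩ painted c (transpose β α κ)) f
      inside f with S f
      ... | true  = ⌊transpose≟⌋ α β (c f) κ
      ... | false = refl
      outside : ∀ f → (∁ S ∩ painted (swapped S) κ) f ≡ (∁ S ∩ painted c κ) f
      outside f with S f
      ... | true  = refl
      ... | false = refl

    module _ {v : Fin n} (imbalanced : 3 + colourDegree c v β ≤ colourDegree c v α) where

      private
        t : Trail (λ _ → true) v true
        t = trail (λ _ → true) (<-wellFounded _) v true

      open Trail t

      exhausted : ∀ {b y} → next ≡ b → ⌊ y ≟ end ⌋ ≡ true → degreeIn G (∁ S ∩ painted c (colour b)) y ≡ 0
      exhausted refl y≟end with ≟-true⇒≡ y≟end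
      ... | refl = unused-at-end t

      swap-at : ∀ y → toℕ ⌊ y ≟ v ⌋ + potentialAt (swapped S) y ≤ potentialAt c y
      swap-at y = ∑-exchange α≢β unchanged (begin
        toℕ ⌊ y ≟ v ⌋ + (colourDegree (swapped S) y α ² + colourDegree (swapped S) y β ²)
          ≡⟨ cong₂ (λ a b → toℕ ⌊ y ≟ v ⌋ + (a ² + b ²)) new-α new-β ⟩
        toℕ ⌊ y ≟ v ⌋ + ((sB + pA) ² + (sA + pB) ²)
          ≤⟨ exchange-at-vertex next ⌊ y ≟ end ⌋ ⌊ y ≟ v ⌋ (balance y) exhausted-α exhausted-β imbalanced-at ⟩
        (sA + pA) ² + (sB + pB) ²
          ≡⟨ cong₂ (λ a b → a ² + b ²) (old α) (old β) ⟨
        colourDegree c y α ² + colourDegree c y β ²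
          ∎)
        where
        open ≤-Reasoning
        sA = degreeIn G (S ∩ painted c α) y
        sB = degreeIn G (S ∩ painted c β) y
        pA = degreeIn G (∁ S ∩ painted c α) y
        pB = degreeIn G (∁ S ∩ painted c β) y
        old : ∀ κ → colourDegree c y κ ≡ degreeIn G (S ∩ painted c κ) y + degreeIn G (∁ S ∩ painted c κ) y
        old κ = degreeIn-split G S (painted c κ) y
        new-α : colourDegree (swapped S) y α ≡ sB + pA
        new-α = trans (colourDegree-swapped S y α)
                      (cong (λ κ → degreeIn G (S ∩ painted c κ) y + pA) (transpose-matchʳ (α≢β ∘ sym)))
        new-β : colourDegree (swapped S) y β ≡ sA + pB
        new-β = trans (colourDegree-swapped S y β)
                      (cong (λ κ → degreeIn G (S ∩ painted c κ) y + pB) (transpose-matchˡ β α))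
        unchanged : ∀ κ → κ ≢ α → κ ≢ β → colourDegree (swapped S) y κ ² ≡ colourDegree c y κ ²
        unchanged κ κ≢α κ≢β = cong _² (begin-equality
          colourDegree (swapped S) y κ
            ≡⟨ colourDegree-swapped S y κ ⟩
          degreeIn G (S ∩ painted c (transpose β α κ)) y + degreeIn G (∁ S ∩ painted c κ) y
            ≡⟨ cong (λ κ′ → degreeIn G (S ∩ painted c κ′) y + pκ) (transpose-other κ≢β κ≢α) ⟩
          degreeIn G (S ∩ painted c κ) y + degreeIn G (∁ S ∩ painted c κ) y
            ≡⟨ old κ ⟨
          colourDegree c y κ
            ∎)
          where pκ = degreeIn G (∁ S ∩ painted c κ) y
        exhausted-α : ⌊ y ≟ end ⌋ ∧ next ≡ true → pA ≡ 0
        exhausted-α at-end with ∧-true⁻ at-end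
        ... | y≟end , next≡true = exhausted next≡true y≟end
        exhausted-β : ⌊ y ≟ end ⌋ ∧ not next ≡ true → pB ≡ 0
        exhausted-β at-end with ∧-true⁻ at-end
        ... | y≟end , not-next≡true = exhausted (trans (sym (not-involutive next)) (cong not not-next≡true)) y≟end
        imbalanced-at : ⌊ y ≟ v ⌋ ≡ true → 3 + sB + pB ≤ sA + pA
        imbalanced-at y≟v with ≟-true⇒≡ y≟v
        ... | refl = subst₂ (λ a b → 3 + a ≤ b) (old β) (old α) imbalanced

      imbalance⇒smaller-potential : ∃ λ c′ → potential c′ < potential c
      imbalance⇒smaller-potential = swapped S , ∑-mono-< (∈-allFin v) (λ y → ≤-trans (m≤n+m _ _) (swap-at y)) at-v
        where
        at-v : 1 + potentialAt (swapped S) v ≤ potentialAt c v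
        at-v = subst (λ b → toℕ b + potentialAt (swapped S) v ≤ potentialAt c v) (⌊≟⌋-refl v) (swap-at v)

  balanced-colouring : EdgeColouring G k → Σ (EdgeColouring G k) Balanced
  balanced-colouring c₀ = descend c₀ (<-wellFounded (potential c₀))
    where
    descend : ∀ c → Acc _<_ (potential c) → Σ (EdgeColouring G k) Balanced
    descend c (acc smaller) with any? (λ y → any? λ α → any? λ β → 3 + colourDegree c y β ≤? colourDegree c y α)
    ... | no  balanced = c , λ y α β → ≤-pred (≰⇒> λ imbalanced → balanced (y , α , β , imbalanced))
    ... | yes (y , α , β , imbalanced) with imbalance⇒smaller-potential c (α≢β imbalanced) {y} imbalanced
      where
      α≢β : 3 + colourDegree c y β ≤ colourDegree c y α → α ≢ β
      α≢β 3+d≤d refl = 1+n≰n (m+n≤o⇒n≤o 2 3+d≤d)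
    ...   | c′ , c′<c = descend c′ (smaller c′<c)

  degree≡∑colourDegree : ∀ (c : EdgeColouring G k) y → degree G y ≡ ∑ᶠ (colourDegree c y)
  degree≡∑colourDegree c y = begin
    degree G y
      ≡⟨ count-incident≡degree G y ⟨
    count (incident G y) (edges G)
      ≡⟨ ∑-cong (edges G) (λ f _ → sym (∑-δ (c f) (λ _ → toℕ (incident G y f)))) ⟩
    ∑ (λ f → ∑ᶠ (λ κ → if painted c κ f then toℕ (incident G y f) else 0)) (edges G)
      ≡⟨ ∑-comm _ (edges G) (allFin k) ⟩
    ∑ᶠ (λ κ → ∑ (λ f → if painted c κ f then toℕ (incident G y f) else 0) (edges G))
      ≡⟨ ∑-cong (allFin k) (λ κ _ → ∑-cong (edges G) (λ f _ → if-toℕ (painted c κ f))) ⟩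
    ∑ᶠ (colourDegree c y)
      ∎
    where
    open ≡-Reasoning
    if-toℕ : ∀ {i} p → (if p then toℕ i else 0) ≡ toℕ (p ∧ i)
    if-toℕ true  = refl
    if-toℕ false = refl

-- Three colours

share-of-three : ∀ {a b c s} → a + b + c ≡ s → a ≤ 2 + b → a ≤ 2 + c → 9 ≤ s → 1 + 2 * a ≤ s
share-of-three {a} {b} {c} refl a≤2+b a≤2+c 9≤s with a ≤? 4
... | yes a≤4 = ≤-trans (+-monoʳ-≤ 1 (*-monoʳ-≤ 2 a≤4)) 9≤s
... | no  a≰4 = +-cancelʳ-≤ 4 _ _ (begin
  1 + 2 * a + 4                    ≡⟨ +-comm (1 + 2 * a) 4 ⟩
  5 + 2 * a                        ≤⟨ +-monoˡ-≤ (2 * a) (≰⇒> a≰4) ⟩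
  a + 2 * a                        ≤⟨ +-monoʳ-≤ a (+-mono-≤ a≤2+b (+-monoˡ-≤ 0 a≤2+c)) ⟩
  a + ((2 + b) + ((2 + c) + 0))    ≡⟨ regroup a b c ⟩
  a + b + c + 4                    ∎)
  where
  open ≤-Reasoning
  regroup : ∀ a b c → a + ((2 + b) + ((2 + c) + 0)) ≡ a + b + c + 4
  regroup = solve-∀

balanced-share : ∀ (d : Fin 3 → ℕ) κ → (∀ κ′ → d κ ≤ 2 + d κ′) → 9 ≤ ∑ᶠ d → 1 + 2 * d κ ≤ ∑ᶠ d
balanced-share d 0F bal = share-of-three {d 0F} {d 1F} {d 2F} (sum₀ (d 0F) (d 1F) (d 2F)) (bal 1F) (bal 2F)
  where sum₀ : ∀ a b c → a + b + c ≡ a + (b + (c + 0))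
        sum₀ = solve-∀
balanced-share d 1F bal = share-of-three {d 1F} {d 0F} {d 2F} (sum₁ (d 0F) (d 1F) (d 2F)) (bal 0F) (bal 2F)
  where sum₁ : ∀ a b c → b + a + c ≡ a + (b + (c + 0))
        sum₁ = solve-∀
balanced-share d 2F bal = share-of-three {d 2F} {d 0F} {d 1F} (sum₂ (d 0F) (d 1F) (d 2F)) (bal 0F) (bal 1F)
  where sum₂ : ∀ a b c → c + a + b ≡ a + (b + (c + 0))
        sum₂ = solve-∀

module _ (G : Graph) (δ≥9 : minDegree≥ G 9) (c : EdgeColouring G 3) (balanced : Balanced G c) where

  colour-share : ∀ y κ → 1 + 2 * colourDegree G c y κ ≤ degree G y
  colour-share y κ = subst (1 + 2 * colourDegree G c y κ ≤_) (sym deg≡∑)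
                           (balanced-share (colourDegree G c y) κ (balanced y κ) (subst (9 ≤_) deg≡∑ (δ≥9 y)))
    where deg≡∑ = degree≡∑colourDegree G c y

  strong-majority : IsStrongMajority G c
  strong-majority (u , w) uw∈G κ =
    subst₂ (λ a b → 2 * a ≤ b) (sym (length-filter≡count _ (edges G))) (sym (length-filter≡count _ (edges G)))
      (begin
        2 * Nκ              ≤⟨ *-monoʳ-≤ 2 Nκ≤ ⟩
        2 * (dκ u + dκ w)   ≤⟨ +-cancelˡ-≤ 2 _ _ 2+2d≤2+N ⟩
        N                   ∎)
    where
    open ≤-Reasoning
    dκ : Fin (Graph.n G) → ℕ
    dκ y = colourDegree G c y κ
    N  = count (adjacentEdges G (u , w)) (edges G)
    Nκ = count (λ f → adjacentEdges G (u , w) f ∧ painted G c κ f) (edges G)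
    t  = toℕ (painted G c κ (u , w))
    Nκ≤ : Nκ ≤ dκ u + dκ w
    Nκ≤ = subst (Nκ ≤_) (count-adjacent G uw∈G (painted G c κ)) (≤-trans (m≤m+n Nκ t) (m≤m+n (Nκ + t) t))
    N+2≡ : N + 1 + 1 ≡ degree G u + degree G w
    N+2≡ = trans (cong (λ m → m + 1 + 1) (∑-cong (edges G) (λ f _ → cong toℕ (sym (∧-identityʳ _)))))
           (trans (count-adjacent G uw∈G (λ _ → true))
                  (cong₂ _+_ (count-incident≡degree G u) (count-incident≡degree G w)))
    2+2d≤2+N : 2 + 2 * (dκ u + dκ w) ≤ 2 + N
    2+2d≤2+N = begin
      2 + 2 * (dκ u + dκ w)               ≡⟨ split-2 (dκ u) (dκ w) ⟩
      1 + 2 * dκ u + (1 + 2 * dκ w)       ≤⟨ +-mono-≤ (colour-share u κ) (colour-share w κ) ⟩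
      degree G u + degree G w             ≡⟨ N+2≡ ⟨
      N + 1 + 1                           ≡⟨ +-comm (N + 1) 1 ⟩
      1 + (N + 1)                         ≡⟨ cong suc (+-comm N 1) ⟩
      2 + N                               ∎
      where
      split-2 : ∀ a b → 2 + 2 * (a + b) ≡ 1 + 2 * a + (1 + 2 * b)
      split-2 = solve-∀

proposition2 : (G : Graph) → minDegree≥ G 9 → MajIndex≤ G 3
proposition2 G δ≥9 with balanced-colouring G (λ _ → 0F)
... | c , balanced = c , strong-majority G δ≥9 c balanced
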